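{- Let $S$ and $X$ be nonnegative integers. The number of unordered pairs $\{a,b\}$ of positive integers with $a+b=S$ and $a\oplus b = X$ equals $f(S,X)$, where $$f(S,X)=\begin{cases} 0 & \text{if } S-X \text{ is odd},\\ 0 & \text{if } S-X \text{ is even and for some } i \text{ the } i\text{th binary digit of } \tfrac{S-X}{2} \text{ and of } X \text{ both equal } 1,\\ 2^{g(X)-1}-1 & \text{otherwise, if } S=X,\\ 2^{g(X)-1} & \text{otherwise (} S-X \text{ even).}\end{cases}$$ (The cases are checked in the order listed.)
   Context: $\oplus$ denotes bitwise exclusive-or of nonnegative integers. For a nonnegative integer $n$, $g(n)$ denotes the number of $1$s in the binary expansion of $n$ (so $g(0)=0$, $g(1)=1$, and $g(n)=(n \bmod 2)+g(\lfloor n/2\rfloor)$). Binary digits of a negative integer are taken in two's complement. -}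

module Defs where

open import Data.Nat using (ℕ; zero; suc; _+_; _*_; _≤_; _≤ᵇ_; _≡ᵇ_)
open import Data.Nat.DivMod using (_/_; _%_)
open import Data.Integer using (ℤ; +_; -[1+_])
open import Data.Bool using (Bool; true; false; _∧_; if_then_else_)
open import Data.List using (List; filterᵇ; upTo; length)

bitXor : ℕ → ℕ → ℕ
bitXor a b = if a ≡ᵇ b then 0 else 1

-- xor with fuel; the fuel only has to exceed the bit-length of both arguments
xorF : ℕ → ℕ → ℕ → ℕ
xorF zero    a b = 0
xorF (suc k) a b = bitXor (a % 2) (b % 2) + 2 * xorF k (a / 2) (b / 2)

_⊕_ : ℕ → ℕ → ℕ
a ⊕ b = xorF (a + b) a b

-- number of ones in the binary expansion: g(n) = (n mod 2) + g(⌊n/2⌋), g 0 = 0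
gF : ℕ → ℕ → ℕ
gF zero    n = 0
gF (suc k) n = n % 2 + gF k (n / 2)

g : ℕ → ℕ
g n = gF n n

halfℤ : ℤ → ℤ
halfℤ (+ n)     = + (n / 2)
halfℤ -[1+ n ]  = -[1+ (n / 2) ]

-- lowest binary digit (two's complement for negatives), as 0 or 1
lowBit : ℤ → ℕ
lowBit (+ n)     = n % 2
lowBit -[1+ n ]  = if n % 2 ≡ᵇ 0 then 1 else 0

digit : ℤ → ℕ → ℕ
digit d zero    = lowBit d
digit d (suc i) = digit (halfℤ d) i

-- number of unordered pairs {a,b} of positive integers with a+b=S and a⊕b=X,
-- each pair listed once as a ≤ b = S - a with a ∈ {1,…,S}
count : ℕ → ℕ → ℕ
count S X = length (filterᵇ ok (upTo (suc S)))
  where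
  ok : ℕ → Bool
  ok a = (1 ≤ᵇ a) ∧ (a ≤ᵇ (S Data.Nat.∸ a)) ∧ (1 ≤ᵇ (S Data.Nat.∸ a))
         ∧ ((a ⊕ (S Data.Nat.∸ a)) ≡ᵇ X)

{-# OPTIONS --safe #-}
-- Adding a and b digit by digit, each position contributes its xor bit to a ⊕ b and its carry
-- one place up, so a + b = (a ⊕ b) + 2D where D (the carries) shares no binary digit with a ⊕ b.
-- Hence solutions exist only when S = X + 2D with D, X bit-disjoint; conversely, peeling off the
-- lowest digits of X and D shows that the ordered solutions (a, S − a), 0 ≤ a ≤ S, then number
-- 2^g(X): every 1-digit of X may go to either summand, everything else is forced.  Unordered
-- pairs of positive integers drop (0, S) and (S, 0), which solve iff S = X, and halve the rest,
-- the midpoint a = S − a being a solution only when X = 0.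
module Submission where

open import Defs
open import Data.Nat using (ℕ; _∸_; _^_)
open import Data.Integer using (ℤ; +_; _-_)
open import Data.Integer.Divisibility using (_∣_)
open import Data.Product using (_×_; ∃)
open import Relation.Nullary using (¬_)
open import Relation.Binary.PropositionalEquality using (_≡_; _≢_)

open import Data.Bool using (Bool; true; false; T; if_then_else_; _∧_)
open import Data.Bool.Properties using (T-≡)
open import Data.Empty using (⊥-elim)
open import Data.Integer using (-[1+_]; -_)
open import Data.Integer.Properties using ([+m]-[+n]≡m⊖n; ⊖-≥; ⊖-≰)
open import Data.List using (filterᵇ; applyUpTo; length)
open import Data.Nat using (zero; suc; _+_; _*_; _≤_; _<_; z≤n; s≤s; _≡ᵇ_; _<ᵇ_; _≤ᵇ_; _≟_; _≤?_)
open import Data.Nat.Divisibility using (divides; divides-refl)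
open import Data.Nat.DivMod
  using (_/_; _%_; m≡m%n+[m/n]*n; [m+kn]%n≡m%n; m<n⇒m%n≡m; m%n<n; m*n/n≡m; +-distrib-/-∣ʳ; /-monoˡ-≤; m/n<m; m/n≤m)
open import Data.Nat.Properties
open import Data.Nat.Tactic.RingSolver using (solve-∀)
open import Data.Product using (_,_)
open import Data.Sum using (_⊎_; inj₁; inj₂)
open import Function using (_∘_; id; Equivalence)
open import Relation.Nullary using (yes; no)
open import Relation.Binary.PropositionalEquality

n%2≤1 : ∀ n → n % 2 ≤ 1
n%2≤1 n = ≤-pred (m%n<n n 2)

n≡n%2+2*[n/2] : ∀ n → n ≡ n % 2 + 2 * (n / 2)
n≡n%2+2*[n/2] n = trans (m≡m%n+[m/n]*n n 2) (cong (_+_ (n % 2)) (*-comm (n / 2) 2))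

[b+2*n]%2≡b : ∀ {b} n → b ≤ 1 → (b + 2 * n) % 2 ≡ b
[b+2*n]%2≡b {b} n b≤1 = begin
  (b + 2 * n) % 2  ≡⟨ cong (λ t → (b + t) % 2) (*-comm 2 n) ⟩
  (b + n * 2) % 2  ≡⟨ [m+kn]%n≡m%n b n 2 ⟩
  b % 2            ≡⟨ m<n⇒m%n≡m (s≤s b≤1) ⟩
  b                ∎
  where open ≡-Reasoning

[b+2*n]/2≡n : ∀ {b} n → b ≤ 1 → (b + 2 * n) / 2 ≡ n
[b+2*n]/2≡n {b} n b≤1 = begin
  (b + 2 * n) / 2    ≡⟨ cong (λ t → (b + t) / 2) (*-comm 2 n) ⟩
  (b + n * 2) / 2    ≡⟨ +-distrib-/-∣ʳ b (divides-refl n) ⟩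
  b / 2 + n * 2 / 2  ≡⟨ cong₂ _+_ (half b≤1) (m*n/n≡m n 2) ⟩
  n                  ∎
  where
  open ≡-Reasoning
  half : ∀ {b} → b ≤ 1 → b / 2 ≡ 0
  half z≤n       = refl
  half (s≤s z≤n) = refl

n≤1+k⇒n/2≤k : ∀ {n k} → n ≤ suc k → n / 2 ≤ k
n≤1+k⇒n/2≤k {n} {k} n≤1+k = ≤-pred (≤-<-trans (/-monoˡ-≤ 2 n≤1+k) (m/n<m (suc k) 2 (s≤s (s≤s z≤n))))

T-injective : ∀ {x y} → (T x → T y) → (T y → T x) → x ≡ y
T-injective {false} {false} _ _ = refl
T-injective {false} {true}  _ y⇒x = ⊥-elim (y⇒x _)
T-injective {true}  {false} x⇒y _ = ⊥-elim (x⇒y _)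
T-injective {true}  {true}  _ _ = refl

≡ᵇ-refl : ∀ n → (n ≡ᵇ n) ≡ true
≡ᵇ-refl n = Equivalence.to T-≡ (≡⇒≡ᵇ n n refl)

≢⇒≡ᵇ≡false : ∀ {m n} → m ≢ n → (m ≡ᵇ n) ≡ false
≢⇒≡ᵇ≡false {m} {n} m≢n = T-injective (m≢n ∘ ≡ᵇ⇒≡ m n) (λ ())

≡ᵇ-comm : ∀ m n → (m ≡ᵇ n) ≡ (n ≡ᵇ m)
≡ᵇ-comm m n = T-injective (≡⇒≡ᵇ n m ∘ sym ∘ ≡ᵇ⇒≡ m n) (≡⇒≡ᵇ m n ∘ sym ∘ ≡ᵇ⇒≡ n m)

xorF-fuel : ∀ k l a b → a ≤ k → b ≤ k → a ≤ l → b ≤ l → xorF k a b ≡ xorF l a b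
xorF-fuel zero    zero    _       _       _   _   _   _   = refl
xorF-fuel zero    (suc l) zero    zero    _   _   _   _   = cong (2 *_) (xorF-fuel zero l 0 0 z≤n z≤n z≤n z≤n)
xorF-fuel (suc k) zero    zero    zero    _   _   _   _   = cong (2 *_) (xorF-fuel k zero 0 0 z≤n z≤n z≤n z≤n)
xorF-fuel (suc k) (suc l) a       b       a≤k b≤k a≤l b≤l =
  cong (λ t → bitXor (a % 2) (b % 2) + 2 * t)
       (xorF-fuel k l (a / 2) (b / 2) (n≤1+k⇒n/2≤k a≤k) (n≤1+k⇒n/2≤k b≤k) (n≤1+k⇒n/2≤k a≤l) (n≤1+k⇒n/2≤k b≤l))

⊕-step : ∀ a b → a ⊕ b ≡ bitXor (a % 2) (b % 2) + 2 * ((a / 2) ⊕ (b / 2))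
⊕-step a b = begin
  xorF (a + b) a b        ≡⟨ xorF-fuel (a + b) (suc (a + b)) a b a≤a+b b≤a+b (m≤n⇒m≤1+n a≤a+b) (m≤n⇒m≤1+n b≤a+b) ⟩
  xorF (suc (a + b)) a b  ≡⟨ cong (λ t → bitXor (a % 2) (b % 2) + 2 * t)
                                  (xorF-fuel (a + b) (a / 2 + b / 2) (a / 2) (b / 2) a/2≤ b/2≤ (m≤m+n _ _) (m≤n+m _ _)) ⟩
  bitXor (a % 2) (b % 2) + 2 * ((a / 2) ⊕ (b / 2)) ∎
  where
  open ≡-Reasoning
  a≤a+b : a ≤ a + b
  a≤a+b = m≤m+n a b
  b≤a+b : b ≤ a + b
  b≤a+b = m≤n+m b a
  a/2≤ : a / 2 ≤ a + b
  a/2≤ = ≤-trans (m/n≤m a 2) a≤a+b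
  b/2≤ : b / 2 ≤ a + b
  b/2≤ = ≤-trans (m/n≤m b 2) b≤a+b

⊕-bits : ∀ {b c} m n → b ≤ 1 → c ≤ 1 → (b + 2 * m) ⊕ (c + 2 * n) ≡ bitXor b c + 2 * (m ⊕ n)
⊕-bits {b} {c} m n b≤1 c≤1 = trans (⊕-step (b + 2 * m) (c + 2 * n))
  (cong₂ (λ r t → r + 2 * t) (cong₂ bitXor ([b+2*n]%2≡b m b≤1) ([b+2*n]%2≡b n c≤1))
                              (cong₂ _⊕_ ([b+2*n]/2≡n m b≤1) ([b+2*n]/2≡n n c≤1)))

xorF-comm : ∀ k a b → xorF k a b ≡ xorF k b a
xorF-comm zero    a b = refl
xorF-comm (suc k) a b =
  cong₂ (λ r t → (if r then 0 else 1) + 2 * t) (≡ᵇ-comm (a % 2) (b % 2)) (xorF-comm k (a / 2) (b / 2))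

⊕-comm : ∀ a b → a ⊕ b ≡ b ⊕ a
⊕-comm a b = trans (xorF-comm (a + b) a b) (cong (λ k → xorF k b a) (+-comm a b))

⊕-self : ∀ a → a ⊕ a ≡ 0
⊕-self a = go (a + a) a
  where
  go : ∀ k a → xorF k a a ≡ 0
  go zero    a = refl
  go (suc k) a rewrite ≡ᵇ-refl (a % 2) | go k (a / 2) = refl

⊕-identityˡ : ∀ a → 0 ⊕ a ≡ a
⊕-identityˡ a = go a a ≤-refl
  where
  bitXor-0 : ∀ {r} → r ≤ 1 → bitXor 0 r ≡ r
  bitXor-0 z≤n       = refl
  bitXor-0 (s≤s z≤n) = refl
  go : ∀ k a → a ≤ k → xorF k 0 a ≡ a
  go zero    zero _ = refl
  go (suc k) a a≤k =
    trans (cong₂ (λ r t → r + 2 * t) (bitXor-0 (n%2≤1 a)) (go k (a / 2) (n≤1+k⇒n/2≤k a≤k))) (sym (n≡n%2+2*[n/2] a))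

⊕-identityʳ : ∀ a → a ⊕ 0 ≡ a
⊕-identityʳ a = trans (⊕-comm a 0) (⊕-identityˡ a)

gF-fuel : ∀ k l n → n ≤ k → n ≤ l → gF k n ≡ gF l n
gF-fuel zero    zero    _    _   _   = refl
gF-fuel zero    (suc l) zero _   _   = gF-fuel zero l 0 z≤n z≤n
gF-fuel (suc k) zero    zero _   _   = gF-fuel k zero 0 z≤n z≤n
gF-fuel (suc k) (suc l) n    n≤k n≤l = cong (_+_ (n % 2)) (gF-fuel k l (n / 2) (n≤1+k⇒n/2≤k n≤k) (n≤1+k⇒n/2≤k n≤l))

g-bits : ∀ {b} n → b ≤ 1 → g (b + 2 * n) ≡ b + g n
g-bits {b} n b≤1 = begin
  gF a a                ≡⟨ gF-fuel a (suc a) a ≤-refl (n≤1+n a) ⟩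
  a % 2 + gF a (a / 2)  ≡⟨ cong₂ _+_ ([b+2*n]%2≡b n b≤1) (gF-fuel a (a / 2) (a / 2) (m/n≤m a 2) ≤-refl) ⟩
  b + g (a / 2)         ≡⟨ cong (λ t → b + g t) ([b+2*n]/2≡n n b≤1) ⟩
  b + g n               ∎
  where
  open ≡-Reasoning
  a : ℕ
  a = b + 2 * n

g≡0⇒≡0 : ∀ n → g n ≡ 0 → n ≡ 0
g≡0⇒≡0 n gn≡0 = go n n ≤-refl gn≡0
  where
  go : ∀ k n → n ≤ k → gF k n ≡ 0 → n ≡ 0
  go zero    n n≤0 _   = n≤0⇒n≡0 n≤0
  go (suc k) n n≤k eq  = begin
    n                    ≡⟨ n≡n%2+2*[n/2] n ⟩
    n % 2 + 2 * (n / 2)  ≡⟨ cong₂ (λ r h → r + 2 * h) (m+n≡0⇒m≡0 (n % 2) eq)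
                                  (go k (n / 2) (n≤1+k⇒n/2≤k n≤k) (m+n≡0⇒n≡0 (n % 2) eq)) ⟩
    0                    ∎
    where open ≡-Reasoning

binary-ind₂ : (P : ℕ → ℕ → Set) → P 0 0 →
              (∀ {b c} m n → b ≤ 1 → c ≤ 1 → P m n → P (b + 2 * m) (c + 2 * n)) →
              ∀ m n → P m n
binary-ind₂ P base step m n = go (m + n) m n (m≤m+n m n) (m≤n+m n m)
  where
  go : ∀ k m n → m ≤ k → n ≤ k → P m n
  go zero    zero zero _ _ = base
  go (suc k) m n m≤k n≤k =
    subst₂ P (sym (n≡n%2+2*[n/2] m)) (sym (n≡n%2+2*[n/2] n))
      (step (m / 2) (n / 2) (n%2≤1 m) (n%2≤1 n) (go k (m / 2) (n / 2) (n≤1+k⇒n/2≤k m≤k) (n≤1+k⇒n/2≤k n≤k)))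

CommonBit : ℤ → ℤ → Set
CommonBit d x = ∃ λ i → digit d i ≡ 1 × digit x i ≡ 1

CommonBit-halfℤ : ∀ {d x} → CommonBit (halfℤ d) (halfℤ x) → CommonBit d x
CommonBit-halfℤ (i , d₁ , x₁) = suc i , d₁ , x₁

halfℤ-bits⁺ : ∀ {b} n → b ≤ 1 → halfℤ (+ (b + 2 * n)) ≡ + n
halfℤ-bits⁺ n b≤1 = cong +_ ([b+2*n]/2≡n n b≤1)

halfℤ-bits⁻ : ∀ {b} n → b ≤ 1 → halfℤ -[1+ (b + 2 * n) ] ≡ -[1+ n ]
halfℤ-bits⁻ n b≤1 = cong -[1+_] ([b+2*n]/2≡n n b≤1)

¬CommonBit-0ˡ : ∀ x → ¬ CommonBit (+ 0) x
¬CommonBit-0ˡ x (i , 0ᵢ≡1 , _) = 0≢1+n (trans (sym (digit-0 i)) 0ᵢ≡1)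
  where
  digit-0 : ∀ i → digit (+ 0) i ≡ 0
  digit-0 zero    = refl
  digit-0 (suc i) = digit-0 i

CommonBit-bits⁺ : ∀ {b c} m n → b ≤ 1 → c ≤ 1 →
                  (b ≡ 1 × c ≡ 1) ⊎ CommonBit (+ m) (+ n) → CommonBit (+ (b + 2 * m)) (+ (c + 2 * n))
CommonBit-bits⁺ m n b≤1 c≤1 (inj₁ (refl , refl)) = 0 , [b+2*n]%2≡b m b≤1 , [b+2*n]%2≡b n c≤1
CommonBit-bits⁺ m n b≤1 c≤1 (inj₂ common) =
  CommonBit-halfℤ (subst₂ CommonBit (sym (halfℤ-bits⁺ m b≤1)) (sym (halfℤ-bits⁺ n c≤1)) common)

CommonBit-bits⁻ : ∀ {b c} m n → b ≤ 1 → c ≤ 1 →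
                  CommonBit (+ (b + 2 * m)) (+ (c + 2 * n)) → (b ≡ 1 × c ≡ 1) ⊎ CommonBit (+ m) (+ n)
CommonBit-bits⁻ m n b≤1 c≤1 (zero , b₁ , c₁) =
  inj₁ (trans (sym ([b+2*n]%2≡b m b≤1)) b₁ , trans (sym ([b+2*n]%2≡b n c≤1)) c₁)
CommonBit-bits⁻ m n b≤1 c≤1 (suc i , m₁ , n₁) =
  inj₂ (i , subst (λ d → digit d i ≡ 1) (halfℤ-bits⁺ m b≤1) m₁ , subst (λ x → digit x i ≡ 1) (halfℤ-bits⁺ n c≤1) n₁)

¬CommonBit-halves : ∀ {b c} m n → b ≤ 1 → c ≤ 1 → ¬ CommonBit (+ (b + 2 * m)) (+ (c + 2 * n)) → ¬ CommonBit (+ m) (+ n)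
¬CommonBit-halves m n b≤1 c≤1 disjoint = disjoint ∘ CommonBit-bits⁺ m n b≤1 c≤1 ∘ inj₂

-- -[1+ m ] is the bitwise complement of m; if it shared no digit with n, every digit of n
-- would be a digit of m, forcing n ≤ m.
CommonBit-complement : ∀ m n → m < n → CommonBit -[1+ m ] (+ n)
CommonBit-complement = binary-ind₂ (λ m n → m < n → CommonBit -[1+ m ] (+ n)) (λ ()) step
  where
  lift : ∀ {b c} m n → b ≤ 1 → c ≤ 1 → CommonBit -[1+ m ] (+ n) → CommonBit -[1+ (b + 2 * m) ] (+ (c + 2 * n))
  lift m n b≤1 c≤1 common = CommonBit-halfℤ (subst₂ CommonBit (sym (halfℤ-bits⁻ m b≤1)) (sym (halfℤ-bits⁺ n c≤1)) common)
  halves-< : ∀ {b c} m n → c ≤ b → b + 2 * m < c + 2 * n → m < n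
  halves-< {b} {c} m n c≤b lt = *-cancelˡ-< 2 m n (+-cancelˡ-< b (2 * m) (2 * n) (<-≤-trans lt (+-monoˡ-≤ (2 * n) c≤b)))
  step : ∀ {b c} m n → b ≤ 1 → c ≤ 1 → (m < n → CommonBit -[1+ m ] (+ n)) →
         b + 2 * m < c + 2 * n → CommonBit -[1+ (b + 2 * m) ] (+ (c + 2 * n))
  step m n z≤n z≤n       ih lt = lift m n z≤n z≤n (ih (halves-< {0} {0} m n z≤n lt))
  step m n z≤n (s≤s z≤n) ih lt = 0 , cong (λ r → if r ≡ᵇ 0 then 1 else 0) ([b+2*n]%2≡b m z≤n) , [b+2*n]%2≡b n (s≤s z≤n)
  step m n (s≤s z≤n) c≤1 ih lt = lift m n (s≤s z≤n) c≤1 (ih (halves-< m n c≤1 lt))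

-- The hypotheses of the theorem over ℕ: S − X = 2D with D sharing no binary digit with X.
Admissible : ℕ → ℕ → Set
Admissible S X = ∃ λ D → S ≡ X + 2 * D × ¬ CommonBit (+ D) (+ X)

bitXor≤1 : ∀ r s → bitXor r s ≤ 1
bitXor≤1 r s with r ≡ᵇ s
... | true  = z≤n
... | false = s≤s z≤n

half-adder : ∀ {r s} → r ≤ 1 → s ≤ 1 → r + s ≡ bitXor r s + 2 * (r * s)
half-adder z≤n       z≤n       = refl
half-adder z≤n       (s≤s z≤n) = refl
half-adder (s≤s z≤n) z≤n       = refl
half-adder (s≤s z≤n) (s≤s z≤n) = refl

half-adder-exclusive : ∀ {r s} → r ≤ 1 → s ≤ 1 → ¬ (r * s ≡ 1 × bitXor r s ≡ 1)
half-adder-exclusive (s≤s z≤n) (s≤s z≤n) (_ , ())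

+-⊕-admissible : ∀ a b → Admissible (a + b) (a ⊕ b)
+-⊕-admissible = binary-ind₂ (λ a b → Admissible (a + b) (a ⊕ b)) (0 , refl , ¬CommonBit-0ˡ (+ 0)) step
  where
  step : ∀ {r s} a b → r ≤ 1 → s ≤ 1 → Admissible (a + b) (a ⊕ b) →
         Admissible ((r + 2 * a) + (s + 2 * b)) ((r + 2 * a) ⊕ (s + 2 * b))
  step {r} {s} a b r≤1 s≤1 (D , a+b≡ , disjoint) =
    r * s + 2 * D , sum≡ , subst (λ x → ¬ CommonBit (+ (r * s + 2 * D)) (+ x)) (sym (⊕-bits a b r≤1 s≤1)) disjoint′
    where
    open ≡-Reasoning
    x : ℕ
    x = a ⊕ b
    regroup : ∀ r s a b → (r + 2 * a) + (s + 2 * b) ≡ (r + s) + 2 * (a + b)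
    regroup = solve-∀
    carry : ∀ u v x D → (u + 2 * v) + 2 * (x + 2 * D) ≡ (u + 2 * x) + 2 * (v + 2 * D)
    carry = solve-∀
    sum≡ : (r + 2 * a) + (s + 2 * b) ≡ (r + 2 * a) ⊕ (s + 2 * b) + 2 * (r * s + 2 * D)
    sum≡ = begin
      (r + 2 * a) + (s + 2 * b)                     ≡⟨ regroup r s a b ⟩
      (r + s) + 2 * (a + b)                         ≡⟨ cong₂ (λ u v → u + 2 * v) (half-adder r≤1 s≤1) a+b≡ ⟩
      (bitXor r s + 2 * (r * s)) + 2 * (x + 2 * D)  ≡⟨ carry (bitXor r s) (r * s) x D ⟩
      (bitXor r s + 2 * x) + 2 * (r * s + 2 * D)    ≡⟨ cong (_+ 2 * (r * s + 2 * D)) (⊕-bits a b r≤1 s≤1) ⟨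
      (r + 2 * a) ⊕ (s + 2 * b) + 2 * (r * s + 2 * D) ∎
    disjoint′ : ¬ CommonBit (+ (r * s + 2 * D)) (+ (bitXor r s + 2 * x))
    disjoint′ common with CommonBit-bits⁻ D x (*-mono-≤ r≤1 s≤1) (bitXor≤1 r s) common
    ... | inj₁ both = half-adder-exclusive r≤1 s≤1 both
    ... | inj₂ low  = disjoint low

∑ : ℕ → (ℕ → ℕ) → ℕ
∑ zero    f = 0
∑ (suc n) f = f 0 + ∑ n (f ∘ suc)

∑-cong : ∀ n {f g} → (∀ i → i < n → f i ≡ g i) → ∑ n f ≡ ∑ n g
∑-cong zero    f≗g = refl
∑-cong (suc n) f≗g = cong₂ _+_ (f≗g 0 (s≤s z≤n)) (∑-cong n (λ i i<n → f≗g (suc i) (s≤s i<n)))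

∑-zero : ∀ n {f} → (∀ i → i < n → f i ≡ 0) → ∑ n f ≡ 0
∑-zero zero    f≗0 = refl
∑-zero (suc n) f≗0 = cong₂ _+_ (f≗0 0 (s≤s z≤n)) (∑-zero n (λ i i<n → f≗0 (suc i) (s≤s i<n)))

∑-distrib-+ : ∀ n f g → ∑ n (λ i → f i + g i) ≡ ∑ n f + ∑ n g
∑-distrib-+ zero    f g = refl
∑-distrib-+ (suc n) f g = trans (cong (_+_ (f 0 + g 0)) (∑-distrib-+ n (f ∘ suc) (g ∘ suc))) (swap (f 0) (g 0) _ _)
  where
  swap : ∀ a b c d → a + b + (c + d) ≡ a + c + (b + d)
  swap = solve-∀

∑-snoc : ∀ n f → ∑ (suc n) f ≡ ∑ n f + f n
∑-snoc zero    f = +-comm (f 0) 0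
∑-snoc (suc n) f = trans (cong (_+_ (f 0)) (∑-snoc n (f ∘ suc))) (sym (+-assoc (f 0) _ _))

∑-reverse : ∀ n f → ∑ (suc n) (λ i → f (n ∸ i)) ≡ ∑ (suc n) f
∑-reverse zero    f = refl
∑-reverse (suc n) f = begin
  f (suc n) + ∑ (suc n) (λ i → f (n ∸ i))  ≡⟨ cong (_+_ (f (suc n))) (∑-reverse n f) ⟩
  f (suc n) + ∑ (suc n) f                  ≡⟨ +-comm (f (suc n)) _ ⟩
  ∑ (suc n) f + f (suc n)                  ≡⟨ ∑-snoc (suc n) f ⟨
  ∑ (suc (suc n)) f                        ∎
  where open ≡-Reasoning

∑-even-odd : ∀ n f → ∑ (2 * n) f ≡ ∑ n (f ∘ (2 *_)) + ∑ n (f ∘ suc ∘ (2 *_))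
∑-even-odd zero    f = refl
∑-even-odd (suc n) f = begin
  ∑ (2 * suc n) f                                  ≡⟨ cong (λ k → ∑ k f) (*-suc 2 n) ⟩
  f 0 + (f 1 + ∑ (2 * n) (f ∘ suc ∘ suc))          ≡⟨ cong (λ t → f 0 + (f 1 + t)) (∑-even-odd n (f ∘ suc ∘ suc)) ⟩
  f 0 + (f 1 + (A + B))                            ≡⟨ swap (f 0) (f 1) A B ⟩
  (f 0 + A) + (f 1 + B)                            ≡⟨ cong₂ (λ u v → (f 0 + u) + (f 1 + v))
                                                            (∑-cong n (λ i _ → cong f (sym (*-suc 2 i))))
                                                            (∑-cong n (λ i _ → cong (f ∘ suc) (sym (*-suc 2 i)))) ⟩
  ∑ (suc n) (f ∘ (2 *_)) + ∑ (suc n) (f ∘ suc ∘ (2 *_)) ∎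
  where
  open ≡-Reasoning
  A B : ℕ
  A = ∑ n (f ∘ suc ∘ suc ∘ (2 *_))
  B = ∑ n (f ∘ suc ∘ suc ∘ suc ∘ (2 *_))
  swap : ∀ a b c d → a + (b + (c + d)) ≡ (a + c) + (b + d)
  swap = solve-∀

∑-even-odd′ : ∀ n f → ∑ (suc (2 * n)) f ≡ ∑ (suc n) (f ∘ (2 *_)) + ∑ n (f ∘ suc ∘ (2 *_))
∑-even-odd′ n f = begin
  ∑ (suc (2 * n)) f                       ≡⟨ ∑-snoc (2 * n) f ⟩
  ∑ (2 * n) f + f (2 * n)                 ≡⟨ cong (_+ f (2 * n)) (∑-even-odd n f) ⟩
  (A + B) + f (2 * n)                     ≡⟨ swap A B (f (2 * n)) ⟩
  (A + f (2 * n)) + B                     ≡⟨ cong (_+ B) (∑-snoc n (f ∘ (2 *_))) ⟨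
  ∑ (suc n) (f ∘ (2 *_)) + B              ∎
  where
  open ≡-Reasoning
  A B : ℕ
  A = ∑ n (f ∘ (2 *_))
  B = ∑ n (f ∘ suc ∘ (2 *_))
  swap : ∀ a b c → (a + b) + c ≡ (a + c) + b
  swap = solve-∀

-- Ordered solutions

ind : Bool → ℕ
ind true  = 1
ind false = 0

splits : ℕ → ℕ → ℕ → Bool
splits S X a = (a ⊕ (S ∸ a)) ≡ᵇ X

ordered : ℕ → ℕ → ℕ
ordered S X = ∑ (suc S) (λ a → ind (splits S X a))

≡ᵇ-cancel : ∀ k m n → (k + 2 * m ≡ᵇ k + 2 * n) ≡ (m ≡ᵇ n)
≡ᵇ-cancel k m n = T-injective
  (≡⇒≡ᵇ m n ∘ *-cancelˡ-≡ m n 2 ∘ +-cancelˡ-≡ k (2 * m) (2 * n) ∘ ≡ᵇ⇒≡ _ _)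
  (≡⇒≡ᵇ _ _ ∘ cong (λ t → k + 2 * t) ∘ ≡ᵇ⇒≡ m n)

[b+2m]∸2n≡b+2[m∸n] : ∀ b {m n} → n ≤ m → (b + 2 * m) ∸ 2 * n ≡ b + 2 * (m ∸ n)
[b+2m]∸2n≡b+2[m∸n] b {m} {n} n≤m =
  trans (+-∸-assoc b (*-monoʳ-≤ 2 n≤m)) (cong (_+_ b) (sym (*-distribˡ-∸ 2 m n)))

splits-bits : ∀ {b c} S s x i → b ≤ 1 → c ≤ 1 → S ∸ (b + 2 * i) ≡ c + 2 * (s ∸ i) →
              splits S (bitXor b c + 2 * x) (b + 2 * i) ≡ splits s x i
splits-bits {b} {c} S s x i b≤1 c≤1 S∸a≡ = begin
  ((b + 2 * i) ⊕ (S ∸ (b + 2 * i)) ≡ᵇ bitXor b c + 2 * x)       ≡⟨ cong (λ t → ((b + 2 * i) ⊕ t ≡ᵇ bitXor b c + 2 * x)) S∸a≡ ⟩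
  ((b + 2 * i) ⊕ (c + 2 * (s ∸ i)) ≡ᵇ bitXor b c + 2 * x)       ≡⟨ cong (_≡ᵇ bitXor b c + 2 * x) (⊕-bits i (s ∸ i) b≤1 c≤1) ⟩
  (bitXor b c + 2 * (i ⊕ (s ∸ i)) ≡ᵇ bitXor b c + 2 * x)        ≡⟨ ≡ᵇ-cancel (bitXor b c) (i ⊕ (s ∸ i)) x ⟩
  (i ⊕ (s ∸ i) ≡ᵇ x)                                             ∎
  where open ≡-Reasoning

ordered-odd : ∀ s x → ordered (1 + 2 * s) (1 + 2 * x) ≡ 2 * ordered s x
ordered-odd s x = begin
  ∑ (2 + 2 * s) F                                       ≡⟨ cong (λ k → ∑ k F) (*-suc 2 s) ⟨
  ∑ (2 * suc s) F                                       ≡⟨ ∑-even-odd (suc s) F ⟩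
  ∑ (suc s) (F ∘ (2 *_)) + ∑ (suc s) (F ∘ suc ∘ (2 *_)) ≡⟨ cong₂ _+_ (∑-cong (suc s) even) (∑-cong (suc s) odd) ⟩
  ordered s x + ordered s x                             ≡⟨ cong (_+_ (ordered s x)) (+-identityʳ (ordered s x)) ⟨
  2 * ordered s x                                       ∎
  where
  open ≡-Reasoning
  F : ℕ → ℕ
  F a = ind (splits (1 + 2 * s) (1 + 2 * x) a)
  even : ∀ i → i < suc s → F (2 * i) ≡ ind (splits s x i)
  even i i<1+s = cong ind (splits-bits (1 + 2 * s) s x i z≤n (s≤s z≤n) ([b+2m]∸2n≡b+2[m∸n] 1 (≤-pred i<1+s)))
  odd : ∀ i → i < suc s → F (suc (2 * i)) ≡ ind (splits s x i)
  odd i i<1+s = cong ind (splits-bits (1 + 2 * s) s x i (s≤s z≤n) z≤n ([b+2m]∸2n≡b+2[m∸n] 0 (≤-pred i<1+s)))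

ordered-even : ∀ s x → ordered (2 * suc s) (2 * x) ≡ ordered (suc s) x + ordered s x
ordered-even s x = begin
  ∑ (suc (2 * suc s)) F                                     ≡⟨ ∑-even-odd′ (suc s) F ⟩
  ∑ (suc (suc s)) (F ∘ (2 *_)) + ∑ (suc s) (F ∘ suc ∘ (2 *_)) ≡⟨ cong₂ _+_ (∑-cong (suc (suc s)) even) (∑-cong (suc s) odd) ⟩
  ordered (suc s) x + ordered s x                           ∎
  where
  open ≡-Reasoning
  F : ℕ → ℕ
  F a = ind (splits (2 * suc s) (2 * x) a)
  even : ∀ i → i < suc (suc s) → F (2 * i) ≡ ind (splits (suc s) x i)
  even i i<2+s = cong ind (splits-bits (2 * suc s) (suc s) x i z≤n z≤n ([b+2m]∸2n≡b+2[m∸n] 0 (≤-pred i<2+s)))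
  odd : ∀ i → i < suc s → F (suc (2 * i)) ≡ ind (splits s x i)
  odd i i<1+s = cong ind (splits-bits (2 * suc s) s x i (s≤s z≤n) (s≤s z≤n)
    (trans (cong (_∸ suc (2 * i)) (*-suc 2 s)) ([b+2m]∸2n≡b+2[m∸n] 1 (≤-pred i<1+s))))

splits⇒admissible : ∀ S X a → a ≤ S → T (splits S X a) → Admissible S X
splits⇒admissible S X a a≤S split =
  subst₂ Admissible (m+[n∸m]≡n a≤S) (≡ᵇ⇒≡ _ X split) (+-⊕-admissible a (S ∸ a))

ordered-inadmissible : ∀ S X → ¬ Admissible S X → ordered S X ≡ 0
ordered-inadmissible S X ¬adm = ∑-zero (suc S) term
  where
  term : ∀ a → a < suc S → ind (splits S X a) ≡ 0
  term a a<1+S with splits S X a in split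
  ... | true  = ⊥-elim (¬adm (splits⇒admissible S X a (≤-pred a<1+S) (Equivalence.from T-≡ split)))
  ... | false = refl

¬Admissible-suc : ∀ {s x} → Admissible s x → ¬ Admissible (suc s) x
¬Admissible-suc {s} {x} (D , s≡ , _) (D′ , 1+s≡ , _) =
  even≢odd D′ D (+-cancelˡ-≡ x (2 * D′) (suc (2 * D)) (trans (sym 1+s≡) (trans (cong suc s≡) (sym (+-suc x (2 * D))))))

ordered-double : ∀ s x → Admissible s x → ordered (2 * s) (2 * x) ≡ ordered s x
ordered-double zero    x (D , 0≡x+2D , _) rewrite m+n≡0⇒m≡0 x (sym 0≡x+2D) = refl
ordered-double (suc s) x adm = begin
  ordered (2 * suc s) (2 * x)      ≡⟨ ordered-even s x ⟩
  ordered (suc s) x + ordered s x  ≡⟨ cong (_+_ (ordered (suc s) x)) (ordered-inadmissible s x (λ adm′ → ¬Admissible-suc adm′ adm)) ⟩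
  ordered (suc s) x + 0            ≡⟨ +-identityʳ _ ⟩
  ordered (suc s) x                ∎
  where open ≡-Reasoning

ordered-double-suc : ∀ s x → Admissible s x → ordered (2 * suc s) (2 * x) ≡ ordered s x
ordered-double-suc s x adm =
  trans (ordered-even s x) (cong (_+ ordered s x) (ordered-inadmissible (suc s) x (¬Admissible-suc adm)))

ordered-admissible : ∀ {S X} → Admissible S X → ordered S X ≡ 2 ^ g X
ordered-admissible {X = X} (D , refl , disjoint) = binary-ind₂ P (λ _ → refl) step X D disjoint
  where
  P : ℕ → ℕ → Set
  P X D = ¬ CommonBit (+ D) (+ X) → ordered (X + 2 * D) X ≡ 2 ^ g X
  open ≡-Reasoning
  step : ∀ {r s} x d → r ≤ 1 → s ≤ 1 → P x d → P (r + 2 * x) (s + 2 * d)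
  step x d (s≤s z≤n) (s≤s z≤n) ih disjoint = ⊥-elim (disjoint (CommonBit-bits⁺ d x (s≤s z≤n) (s≤s z≤n) (inj₁ (refl , refl))))
  step x d r≤1@(s≤s z≤n) s≤1@z≤n ih disjoint = begin
    ordered (1 + 2 * x + 2 * (2 * d)) (1 + 2 * x)  ≡⟨ cong (λ S → ordered (suc S) (1 + 2 * x)) (*-distribˡ-+ 2 x (2 * d)) ⟨
    ordered (1 + 2 * (x + 2 * d)) (1 + 2 * x)      ≡⟨ ordered-odd (x + 2 * d) x ⟩
    2 * ordered (x + 2 * d) x                      ≡⟨ cong (2 *_) (ih (¬CommonBit-halves d x s≤1 r≤1 disjoint)) ⟩
    2 ^ (1 + g x)                                  ≡⟨ cong (2 ^_) (g-bits x (s≤s z≤n)) ⟨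
    2 ^ g (1 + 2 * x)                              ∎
  step x d r≤1@z≤n s≤1@z≤n ih disjoint = begin
    ordered (2 * x + 2 * (2 * d)) (2 * x)          ≡⟨ cong (λ S → ordered S (2 * x)) (*-distribˡ-+ 2 x (2 * d)) ⟨
    ordered (2 * (x + 2 * d)) (2 * x)              ≡⟨ ordered-double (x + 2 * d) x (d , refl , ¬CommonBit-halves d x s≤1 r≤1 disjoint) ⟩
    ordered (x + 2 * d) x                          ≡⟨ ih (¬CommonBit-halves d x s≤1 r≤1 disjoint) ⟩
    2 ^ g x                                        ≡⟨ cong (2 ^_) (g-bits x z≤n) ⟨
    2 ^ g (2 * x)                                  ∎
  step x d r≤1@z≤n s≤1@(s≤s z≤n) ih disjoint = begin
    ordered (2 * x + 2 * (1 + 2 * d)) (2 * x)      ≡⟨ cong (λ S → ordered S (2 * x)) (regroup x d) ⟩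
    ordered (2 * suc (x + 2 * d)) (2 * x)          ≡⟨ ordered-double-suc (x + 2 * d) x (d , refl , ¬CommonBit-halves d x s≤1 r≤1 disjoint) ⟩
    ordered (x + 2 * d) x                          ≡⟨ ih (¬CommonBit-halves d x s≤1 r≤1 disjoint) ⟩
    2 ^ g x                                        ≡⟨ cong (2 ^_) (g-bits x z≤n) ⟨
    2 ^ g (2 * x)                                  ∎
    where
    regroup : ∀ x d → 2 * x + 2 * (1 + 2 * d) ≡ 2 * suc (x + 2 * d)
    regroup = solve-∀

-- Unordered pairs

ind-∧ : ∀ a b → ind (a ∧ b) ≡ ind a * ind b
ind-∧ true  b = sym (+-identityʳ (ind b))
ind-∧ false b = refl

ind-<ᵇ-suc : ∀ i k → ind (i <ᵇ suc k) ≡ ind (i <ᵇ k) + ind (i ≡ᵇ k)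
ind-<ᵇ-suc zero    zero    = refl
ind-<ᵇ-suc zero    (suc k) = refl
ind-<ᵇ-suc (suc i) zero    = refl
ind-<ᵇ-suc (suc i) (suc k) = ind-<ᵇ-suc i k

ind-trichotomy : ∀ i k → ind (i <ᵇ k) + ind (i ≡ᵇ k) + ind (k <ᵇ i) ≡ 1
ind-trichotomy zero    zero    = refl
ind-trichotomy zero    (suc k) = refl
ind-trichotomy (suc i) zero    = refl
ind-trichotomy (suc i) (suc k) = ind-trichotomy i k

length-filterᵇ-applyUpTo : ∀ {A : Set} (p : A → Bool) (f : ℕ → A) n → length (filterᵇ p (applyUpTo f n)) ≡ ∑ n (ind ∘ p ∘ f)
length-filterᵇ-applyUpTo p f zero = refl
length-filterᵇ-applyUpTo p f (suc n) with p (f 0)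
... | true  = cong suc (length-filterᵇ-applyUpTo p (f ∘ suc) n)
... | false = length-filterᵇ-applyUpTo p (f ∘ suc) n

∑-reflect : ∀ n f → (∀ i → i ≤ n → f (n ∸ i) ≡ f i) →
            ∑ (suc n) f ≡ 2 * ∑ (suc n) (λ i → f i * ind (i <ᵇ n ∸ i)) + ∑ (suc n) (λ i → f i * ind (i ≡ᵇ n ∸ i))
∑-reflect n f f-sym = begin
  ∑ (suc n) f                         ≡⟨ ∑-cong (suc n) (λ i _ → split i) ⟩
  ∑ (suc n) (λ i → lt i + eq i + gt i) ≡⟨ ∑-distrib-+ (suc n) (λ i → lt i + eq i) gt ⟩
  ∑ (suc n) (λ i → lt i + eq i) + ∑ (suc n) gt ≡⟨ cong₂ _+_ (∑-distrib-+ (suc n) lt eq) gt≡lt ⟩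
  ∑ (suc n) lt + ∑ (suc n) eq + ∑ (suc n) lt ≡⟨ regroup (∑ (suc n) lt) (∑ (suc n) eq) ⟩
  2 * ∑ (suc n) lt + ∑ (suc n) eq     ∎
  where
  open ≡-Reasoning
  lt eq gt : ℕ → ℕ
  lt i = f i * ind (i <ᵇ n ∸ i)
  eq i = f i * ind (i ≡ᵇ n ∸ i)
  gt i = f i * ind (n ∸ i <ᵇ i)
  distrib₃ : ∀ a b c d → a * (b + c + d) ≡ a * b + a * c + a * d
  distrib₃ = solve-∀
  split : ∀ i → f i ≡ lt i + eq i + gt i
  split i = trans (sym (*-identityʳ (f i))) (trans (cong (f i *_) (sym (ind-trichotomy i (n ∸ i)))) (distrib₃ (f i) _ _ _))
  gt≡lt : ∑ (suc n) gt ≡ ∑ (suc n) lt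
  gt≡lt = trans (sym (∑-reverse n gt)) (∑-cong (suc n) λ i i<1+n →
    cong₂ (λ u v → u * ind (v <ᵇ n ∸ i)) (f-sym i (≤-pred i<1+n)) (m∸[m∸n]≡n (≤-pred i<1+n)))
  regroup : ∀ a b → a + b + a ≡ 2 * a + b
  regroup = solve-∀

splits-swap : ∀ S X a → a ≤ S → splits S X (S ∸ a) ≡ splits S X a
splits-swap S X a a≤S =
  cong (_≡ᵇ X) (trans (cong ((S ∸ a) ⊕_) (m∸[m∸n]≡n a≤S)) (⊕-comm (S ∸ a) a))

-- Definitionally the predicate filtered in count.
isPair : ℕ → ℕ → ℕ → Bool
isPair S X a = (1 ≤ᵇ a) ∧ (a ≤ᵇ (S ∸ a)) ∧ (1 ≤ᵇ (S ∸ a)) ∧ splits S X a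

count≡∑ : ∀ S X → count S X ≡ ∑ (suc S) (ind ∘ isPair S X)
count≡∑ S X = length-filterᵇ-applyUpTo (isPair S X) id (suc S)

-- With S = 2 + m, the index i stands for a = 1 + i, whose partner S ∸ a is 1 + (m ∸ i).
module _ (m X : ℕ) where
  private
    S : ℕ
    S = 2 + m
    f : ℕ → ℕ
    f i = ind (splits S X (suc i))
    below middle : ℕ
    below  = ∑ (suc m) (λ i → f i * ind (i <ᵇ m ∸ i))
    middle = ∑ (suc m) (λ i → f i * ind (i ≡ᵇ m ∸ i))

    1+m∸i≡1+[m∸i] : ∀ i → i ≤ m → suc m ∸ i ≡ suc (m ∸ i)
    1+m∸i≡1+[m∸i] i = +-∸-assoc 1

    f-sym : ∀ i → i ≤ m → f (m ∸ i) ≡ f i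
    f-sym i i≤m = begin
      ind (splits S X (suc (m ∸ i)))      ≡⟨ cong (ind ∘ splits S X) (1+m∸i≡1+[m∸i] i i≤m) ⟨
      ind (splits S X (S ∸ suc i))        ≡⟨ cong ind (splits-swap S X (suc i) (s≤s (≤-trans i≤m (n≤1+n m)))) ⟩
      ind (splits S X (suc i))            ∎
      where open ≡-Reasoning

    ordered-split : ordered S X ≡ 2 * (ind (S ≡ᵇ X) + below) + middle
    ordered-split = begin
      e 0 + ∑ (suc (suc m)) (e ∘ suc)            ≡⟨ cong (_+_ (e 0)) (∑-snoc (suc m) (e ∘ suc)) ⟩
      e 0 + (∑ (suc m) (e ∘ suc) + e S)          ≡⟨ cong₂ (λ u v → u + (∑ (suc m) (e ∘ suc) + v)) first last ⟩
      d + (∑ (suc m) f + d)                      ≡⟨ cong (λ t → d + (t + d)) (∑-reflect m f f-sym) ⟩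
      d + (2 * below + middle + d)               ≡⟨ regroup d below middle ⟩
      2 * (d + below) + middle                   ∎
      where
      open ≡-Reasoning
      e : ℕ → ℕ
      e a = ind (splits S X a)
      d : ℕ
      d = ind (S ≡ᵇ X)
      first : e 0 ≡ d
      first = cong (λ t → ind (t ≡ᵇ X)) (⊕-identityˡ S)
      last : e S ≡ d
      last = trans (cong (λ t → ind ((S ⊕ t) ≡ᵇ X)) (n∸n≡0 m)) (cong (λ t → ind (t ≡ᵇ X)) (⊕-identityʳ S))
      regroup : ∀ d b c → d + (2 * b + c + d) ≡ 2 * (d + b) + c
      regroup = solve-∀

    count-split : count S X ≡ below + middle
    count-split = begin
      count S X                                          ≡⟨ count≡∑ S X ⟩
      ∑ (suc (suc m)) (ind ∘ isPair S X ∘ suc)           ≡⟨ ∑-snoc (suc m) (ind ∘ isPair S X ∘ suc) ⟩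
      ∑ (suc m) (ind ∘ isPair S X ∘ suc) + ind (isPair S X S) ≡⟨ cong (λ k → ∑ (suc m) (ind ∘ isPair S X ∘ suc) + ind ((S ≤ᵇ k) ∧ (1 ≤ᵇ k) ∧ ((S ⊕ k) ≡ᵇ X))) (n∸n≡0 m) ⟩
      ∑ (suc m) (ind ∘ isPair S X ∘ suc) + 0              ≡⟨ +-identityʳ _ ⟩
      ∑ (suc m) (ind ∘ isPair S X ∘ suc)                  ≡⟨ ∑-cong (suc m) (λ i i<1+m → term i (≤-pred i<1+m)) ⟩
      ∑ (suc m) (λ i → f i * ind (i <ᵇ m ∸ i) + f i * ind (i ≡ᵇ m ∸ i)) ≡⟨ ∑-distrib-+ (suc m) (λ i → f i * ind (i <ᵇ m ∸ i)) (λ i → f i * ind (i ≡ᵇ m ∸ i)) ⟩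
      below + middle                                     ∎
      where
      open ≡-Reasoning
      term : ∀ i → i ≤ m → ind (isPair S X (suc i)) ≡ f i * ind (i <ᵇ m ∸ i) + f i * ind (i ≡ᵇ m ∸ i)
      term i i≤m = begin
        ind ((i <ᵇ suc m ∸ i) ∧ ((1 ≤ᵇ suc m ∸ i) ∧ splits S X (suc i)))
          ≡⟨ cong (λ k → ind ((i <ᵇ k) ∧ ((1 ≤ᵇ k) ∧ splits S X (suc i)))) (1+m∸i≡1+[m∸i] i i≤m) ⟩
        ind ((i <ᵇ suc (m ∸ i)) ∧ splits S X (suc i))     ≡⟨ ind-∧ (i <ᵇ suc (m ∸ i)) _ ⟩
        ind (i <ᵇ suc (m ∸ i)) * f i                      ≡⟨ cong (_* f i) (ind-<ᵇ-suc i (m ∸ i)) ⟩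
        (ind (i <ᵇ m ∸ i) + ind (i ≡ᵇ m ∸ i)) * f i       ≡⟨ *-comm _ (f i) ⟩
        f i * (ind (i <ᵇ m ∸ i) + ind (i ≡ᵇ m ∸ i))       ≡⟨ *-distribˡ-+ (f i) _ _ ⟩
        f i * ind (i <ᵇ m ∸ i) + f i * ind (i ≡ᵇ m ∸ i)   ∎

    middle≡0 : X ≢ 0 → middle ≡ 0
    middle≡0 X≢0 = ∑-zero (suc m) term
      where
      0≡ᵇX : (0 ≡ᵇ X) ≡ false
      0≡ᵇX = ≢⇒≡ᵇ≡false (X≢0 ∘ sym)
      term : ∀ i → i < suc m → f i * ind (i ≡ᵇ m ∸ i) ≡ 0
      term i i<1+m with i ≡ᵇ m ∸ i in i≡ᵇm∸i
      ... | false = *-zeroʳ (f i)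
      ... | true  = trans (*-identityʳ (f i)) (cong ind (begin
        (suc i ⊕ (suc m ∸ i)) ≡ᵇ X  ≡⟨ cong (λ t → (suc i ⊕ t) ≡ᵇ X) (trans (1+m∸i≡1+[m∸i] i (≤-pred i<1+m)) (cong suc (sym i≡m∸i))) ⟩
        (suc i ⊕ suc i) ≡ᵇ X        ≡⟨ cong (_≡ᵇ X) (⊕-self (suc i)) ⟩
        0 ≡ᵇ X                      ≡⟨ 0≡ᵇX ⟩
        false                       ∎))
        where
        open ≡-Reasoning
        i≡m∸i : i ≡ m ∸ i
        i≡m∸i = ≡ᵇ⇒≡ i (m ∸ i) (Equivalence.from T-≡ i≡ᵇm∸i)

  count-ordered : X ≢ 0 → 2 * (ind (S ≡ᵇ X) + count S X) ≡ ordered S X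
  count-ordered X≢0 = begin
    2 * (ind (S ≡ᵇ X) + count S X)      ≡⟨ cong (λ c → 2 * (ind (S ≡ᵇ X) + c)) count≡below ⟩
    2 * (ind (S ≡ᵇ X) + below)          ≡⟨ +-identityʳ _ ⟨
    2 * (ind (S ≡ᵇ X) + below) + 0      ≡⟨ cong (_+_ (2 * (ind (S ≡ᵇ X) + below))) (middle≡0 X≢0) ⟨
    2 * (ind (S ≡ᵇ X) + below) + middle ≡⟨ ordered-split ⟨
    ordered S X                         ∎
    where
    open ≡-Reasoning
    count≡below : count S X ≡ below
    count≡below = trans count-split (trans (cong (_+_ below) (middle≡0 X≢0)) (+-identityʳ below))

  ordered≡1⇒count≡1 : ordered S X ≡ 1 → count S X ≡ 1
  ordered≡1⇒count≡1 ordered≡1 = begin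
    count S X       ≡⟨ count-split ⟩
    below + middle  ≡⟨ cong (_+ middle) (m+n≡0⇒n≡0 (ind (S ≡ᵇ X)) d+below≡0) ⟩
    middle          ≡⟨ trans (cong (λ k → 2 * k + middle) (sym d+below≡0)) 2*[d+below]+middle≡1 ⟩
    1               ∎
    where
    open ≡-Reasoning
    2*[d+below]+middle≡1 : 2 * (ind (S ≡ᵇ X) + below) + middle ≡ 1
    2*[d+below]+middle≡1 = trans (sym ordered-split) ordered≡1
    2*k+l≡1⇒k≡0 : ∀ k l → 2 * k + l ≡ 1 → k ≡ 0
    2*k+l≡1⇒k≡0 zero    l _  = refl
    2*k+l≡1⇒k≡0 (suc k) l eq with m+n≡0⇒n≡0 k (m+n≡0⇒m≡0 (k + suc (k + 0)) (suc-injective eq))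
    ... | ()
    d+below≡0 : ind (S ≡ᵇ X) + below ≡ 0
    d+below≡0 = 2*k+l≡1⇒k≡0 _ middle 2*[d+below]+middle≡1

  count≤ordered-2+ : count S X ≤ ordered S X
  count≤ordered-2+ = begin
    count S X                           ≡⟨ count-split ⟩
    below + middle                      ≤⟨ +-monoˡ-≤ middle (≤-trans (m≤n+m below (ind (S ≡ᵇ X))) (m≤m+n _ _)) ⟩
    2 * (ind (S ≡ᵇ X) + below) + middle ≡⟨ ordered-split ⟨
    ordered S X                         ∎
    where open ≤-Reasoning

count≤ordered : ∀ S X → count S X ≤ ordered S X
count≤ordered zero          X = z≤n
count≤ordered (suc zero)    X = z≤n
count≤ordered (suc (suc m)) X = count≤ordered-2+ m X

count-inadmissible : ∀ S X → ¬ Admissible S X → count S X ≡ 0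
count-inadmissible S X ¬adm = n≤0⇒n≡0 (subst (count S X ≤_) (ordered-inadmissible S X ¬adm) (count≤ordered S X))

2^g≡2*2^[g∸1] : ∀ X → X ≢ 0 → 2 ^ g X ≡ 2 * 2 ^ (g X ∸ 1)
2^g≡2*2^[g∸1] X X≢0 with g X | g≡0⇒≡0 X
... | zero  | g≡0⇒X≡0 = ⊥-elim (X≢0 (g≡0⇒X≡0 refl))
... | suc k | _       = refl

count-admissible : ∀ S X → Admissible S X → X ≢ 0 → ind (S ≡ᵇ X) + count S X ≡ 2 ^ (g X ∸ 1)
count-admissible zero          X       (D , 0≡X+2D , _) X≢0 = ⊥-elim (X≢0 (m+n≡0⇒m≡0 X (sym 0≡X+2D)))
count-admissible (suc zero)    zero    _                X≢0 = ⊥-elim (X≢0 refl)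
count-admissible (suc zero)    (suc X) (D , 1≡1+X+2D , _) _ rewrite m+n≡0⇒m≡0 X (suc-injective (sym 1≡1+X+2D)) = refl
count-admissible (suc (suc m)) X       adm              X≢0 =
  *-cancelˡ-≡ _ _ 2 (trans (count-ordered m X X≢0) (trans (ordered-admissible adm) (2^g≡2*2^[g∸1] X X≢0)))

count-admissible-0 : ∀ S → Admissible S 0 → S ≢ 0 → count S 0 ≡ 1
count-admissible-0 zero          _              S≢0 = ⊥-elim (S≢0 refl)
count-admissible-0 (suc zero)    (D , 1≡2D , _) _   = ⊥-elim (even≢odd D 0 (sym 1≡2D))
count-admissible-0 (suc (suc m)) adm            _   = ordered≡1⇒count≡1 m 0 (ordered-admissible adm)

count-diagonal : ∀ X → count X X ≡ 2 ^ (g X ∸ 1) ∸ 1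
count-diagonal zero    = refl
count-diagonal (suc X) = begin
  count (suc X) (suc X)                     ≡⟨ m+n∸m≡n 1 _ ⟨
  1 + count (suc X) (suc X) ∸ 1             ≡⟨ cong (λ b → ind b + count (suc X) (suc X) ∸ 1) (≡ᵇ-refl X) ⟨
  ind (X ≡ᵇ X) + count (suc X) (suc X) ∸ 1  ≡⟨ cong (_∸ 1) (count-admissible (suc X) (suc X) adm (λ ())) ⟩
  2 ^ (g (suc X) ∸ 1) ∸ 1                   ∎
  where
  open ≡-Reasoning
  adm : Admissible (suc X) (suc X)
  adm = 0 , sym (+-identityʳ (suc X)) , ¬CommonBit-0ˡ (+ suc X)

count-off-diagonal : ∀ S X → Admissible S X → S ≢ X → count S X ≡ 2 ^ (g X ∸ 1)
count-off-diagonal S X adm S≢X with X ≟ 0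
... | yes refl = count-admissible-0 S adm S≢X
... | no  X≢0  = trans (cong (λ b → ind b + count S X) (sym (≢⇒≡ᵇ≡false S≢X))) (count-admissible S X adm X≢0)

-- The conditions over ℤ

[+m]-[+n]≡+[m∸n] : ∀ {m n} → n ≤ m → + m - + n ≡ + (m ∸ n)
[+m]-[+n]≡+[m∸n] {m} {n} n≤m = trans ([+m]-[+n]≡m⊖n m n) (⊖-≥ n≤m)

halfℤ-difference : ∀ {S X D} → S ∸ X ≡ 2 * D → X ≤ S → halfℤ (+ S - + X) ≡ + D
halfℤ-difference {D = D} S∸X≡2D X≤S = trans (cong halfℤ (trans ([+m]-[+n]≡+[m∸n] X≤S) (cong +_ S∸X≡2D))) (halfℤ-bits⁺ D z≤n)

admissible⇒2∣ : ∀ {S X} → Admissible S X → + 2 ∣ (+ S - + X)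
admissible⇒2∣ {X = X} (D , refl , _) =
  subst (+ 2 ∣_) (sym ([+m]-[+n]≡+[m∸n] (m≤m+n X (2 * D)))) (divides D (trans (m+n∸m≡n X (2 * D)) (*-comm 2 D)))

admissible⇒¬CommonBit : ∀ {S X} → Admissible S X → ¬ CommonBit (halfℤ (+ S - + X)) (+ X)
admissible⇒¬CommonBit {X = X} (D , refl , disjoint) =
  subst (λ d → ¬ CommonBit d (+ X)) (sym (halfℤ-difference (m+n∸m≡n X (2 * D)) (m≤m+n X (2 * D)))) disjoint

admissible : ∀ {S X} → + 2 ∣ (+ S - + X) → ¬ CommonBit (halfℤ (+ S - + X)) (+ X) → Admissible S X
admissible {S} {X} 2∣S-X disjoint with X ≤? S
... | yes X≤S with subst (+ 2 ∣_) ([+m]-[+n]≡+[m∸n] X≤S) 2∣S-X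
...   | divides D S∸X≡D*2 = D , S≡X+2D , subst (λ d → ¬ CommonBit d (+ X)) (halfℤ-difference S∸X≡2D X≤S) disjoint
  where
  S∸X≡2D : S ∸ X ≡ 2 * D
  S∸X≡2D = trans S∸X≡D*2 (*-comm D 2)
  S≡X+2D : S ≡ X + 2 * D
  S≡X+2D = trans (sym (m+[n∸m]≡n X≤S)) (cong (_+_ X) S∸X≡2D)
admissible {S} {X} 2∣S-X disjoint | no X≰S with X ∸ S in X∸S≡
...   | zero  = ⊥-elim (X≰S (m∸n≡0⇒m≤n X∸S≡))
...   | suc n = ⊥-elim (disjoint (subst (λ d → CommonBit d (+ X)) (sym half≡) (CommonBit-complement (n / 2) X n/2<X)))
  where
  half≡ : halfℤ (+ S - + X) ≡ -[1+ n / 2 ]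
  half≡ = cong halfℤ (trans ([+m]-[+n]≡m⊖n S X) (trans (⊖-≰ X≰S) (cong (λ t → - (+ t)) X∸S≡)))
  n/2<X : n / 2 < X
  n/2<X = ≤-trans (s≤s (m/n≤m n 2)) (subst (_≤ X) X∸S≡ (m∸n≤m X S))

theorem7p2 : (S X : ℕ) →
      (¬ ((+ 2) ∣ (+ S - + X)) → count S X ≡ 0)
    × ((+ 2) ∣ (+ S - + X) →
        ∃ (λ i → digit (halfℤ (+ S - + X)) i ≡ 1 × digit (+ X) i ≡ 1) →
        count S X ≡ 0)
    × ((+ 2) ∣ (+ S - + X) →
        ¬ ∃ (λ i → digit (halfℤ (+ S - + X)) i ≡ 1 × digit (+ X) i ≡ 1) →
        S ≡ X → count S X ≡ 2 ^ (g X ∸ 1) ∸ 1)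
    × ((+ 2) ∣ (+ S - + X) →
        ¬ ∃ (λ i → digit (halfℤ (+ S - + X)) i ≡ 1 × digit (+ X) i ≡ 1) →
        S ≢ X → count S X ≡ 2 ^ (g X ∸ 1))
theorem7p2 S X =
    (λ 2∤S-X → count-inadmissible S X (2∤S-X ∘ admissible⇒2∣))
  , (λ _ common → count-inadmissible S X (λ adm → admissible⇒¬CommonBit adm common))
  , (λ { _ _ refl → count-diagonal X })
  , (λ 2∣S-X disjoint → count-off-diagonal S X (admissible 2∣S-X disjoint))
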